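{- For every rooted tree $T$, $$\bar K(T)=\bar\Lambda\prod_{i=1}^d\bar K(T_i),\qquad K(T)=\Lambda\prod_{i=1}^dK(T_i),$$ where $T_1,\dots,T_d$ are the connected components of the forest obtained from $T$ by deleting its root (empty product $=1$).
   Context: A rooted tree is a finite connected acyclic graph with a distinguished vertex (its root); after deleting the root, each component is rooted at the former child of the root it contains. Rooted trees/forests are regarded as posets with $x<y$ iff $x\ne y$ lies on the path from $y$ to the root of its component. $x=(x_1,x_2,\dots)$ are commuting variables, $\mathbb C[[x]]$ the formal power series algebra. For a finite poset $P$ and a map $\sigma:P\to\mathbb N^+$, $x^\sigma=\prod_{i\ge1}x_i^{|\sigma^{ -1}(i)|}$. $\bar K(P)=\sum_\sigma x^\sigma$ over all $\sigma:P\to\mathbb N^+$ with $x>y\Rightarrow\sigma(x)>\sigma(y)$, and $K(P)=\sum_\sigma x^\sigma$ over all $\sigma$ with $x>y\Rightarrow\sigma(x)\ge\sigma(y)$. The shift $S$ is the $\mathbb C$-algebra endomorphism of $\mathbb C[[x]]$ with $S(x_m)=x_{m+1}$; $\bar\Lambda=\sum_{k\ge1}x_kS^k$ and $\Lambda=\sum_{k\ge1}x_kS^{k-1}$, where $x_k$ denotes multiplication by $x_k$. -}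

module Defs where

open import Data.Nat using (ℕ; zero; suc; _+_; _*_; _∸_; _≤ᵇ_; _<ᵇ_; _≡ᵇ_)
open import Data.Bool using (Bool; true; false; not; _∨_; _∧_; if_then_else_)
open import Data.Fin using (Fin; zero; suc; toℕ; splitAt)
open import Data.Fin.Properties using (_≟_)
open import Data.Sum using (inj₁; inj₂)
open import Data.Product using (_×_; _,_)
open import Data.List using (List; []; _∷_; [_]; map; concatMap; length; lookup; allFin; upTo; foldr)
open import Data.Nat.ListAction using (sum)
open import Data.Bool.ListAction using () renaming (all to allL)
open import Data.Vec using (Vec; []; _∷_)
open import Relation.Nullary.Decidable using (⌊_⌋)

data Tree : Set where
  node : List Tree → Tree

-- Vertices of a tree, numbered in preorder: the root is 0, followed by
-- the vertices of the first subtree, then the second, ...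
mutual
  size : Tree → ℕ
  size (node ts) = suc (sizeF ts)

  sizeF : List Tree → ℕ
  sizeF []       = 0
  sizeF (t ∷ ts) = size t + sizeF ts

-- The poset order of the tree: ltT t x y = true iff x ≠ y and x lies on
-- the path from y to the root (i.e. x is a strict ancestor of y).
mutual
  ltT : (t : Tree) → Fin (size t) → Fin (size t) → Bool
  ltT (node ts) zero    zero    = false
  ltT (node ts) zero    (suc _) = true
  ltT (node ts) (suc _) zero    = false
  ltT (node ts) (suc i) (suc j) = ltF ts i j

  ltF : (ts : List Tree) → Fin (sizeF ts) → Fin (sizeF ts) → Bool
  ltF [] () _
  ltF (t ∷ ts) i j with splitAt (size t) i | splitAt (size t) j
  ... | inj₁ a | inj₁ b = ltT t a b
  ... | inj₂ a | inj₂ b = ltF ts a b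
  ... | inj₁ _ | inj₂ _ = false
  ... | inj₂ _ | inj₁ _ = false

-- Formal power series in x₁, x₂, … with coefficients in ℕ.
-- A monomial is an exponent list m = (m₁, …, m_L), standing for
-- x₁^m₁ ⋯ x_L^m_L (list entry k, 0-based, is the exponent of x_{k+1};
-- trailing zeros do not change the monomial).

Mon : Set
Mon = List ℕ

Ser : Set
Ser = Mon → ℕ

-- all maps Fin n → Fin L, as vectors
allVec : (L n : ℕ) → List (Vec (Fin L) n)
allVec L zero    = [ [] ]
allVec L (suc n) = concatMap (λ v → map (λ k → k ∷ v) (allFin L)) (allVec L n)

lookupV : ∀ {A : Set} {n} → Vec A n → Fin n → A
lookupV (x ∷ _)  zero    = x
lookupV (_ ∷ xs) (suc i) = lookupV xs i

occ : ∀ {L n} → Fin L → Vec (Fin L) n → ℕ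
occ k []      = 0
occ k (x ∷ σ) = (if ⌊ x ≟ k ⌋ then 1 else 0) + occ k σ

countB : ∀ {A : Set} → (A → Bool) → List A → ℕ
countB p []       = 0
countB p (x ∷ xs) = (if p x then 1 else 0) + countB p xs

-- Coefficient of x^m in Σ_σ x^σ, σ ranging over maps from the vertex set
-- of the tree t to ℕ⁺ satisfying the order condition `ok`.  A map σ
-- with x^σ = x^m takes values in {1,…,L}, L = length m; the value
-- k : Fin L stands for the positive integer toℕ k + 1 (variable x_{toℕ k + 1}).
-- strict = true : x > y ⇒ σ(x) > σ(y)   (K̄)
-- strict = false: x > y ⇒ σ(x) ≥ σ(y)   (K)
coeffP : Bool → Tree → Ser
coeffP strict t m = countB good (allVec (length m) (size t))
  where
    cmp : ℕ → ℕ → Bool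
    cmp a b = if strict then a <ᵇ b else a ≤ᵇ b
    orderOK : Vec (Fin (length m)) (size t) → Bool
    orderOK σ = allL (λ y → allL (λ x → not (ltT t y x) ∨ cmp (toℕ (lookupV σ y)) (toℕ (lookupV σ x)))
                                (allFin (size t)))
                    (allFin (size t))
    weightOK : Vec (Fin (length m)) (size t) → Bool
    weightOK σ = allL (λ k → occ k σ ≡ᵇ lookup m k) (allFin (length m))
    good : Vec (Fin (length m)) (size t) → Bool
    good σ = orderOK σ ∧ weightOK σ

Kbar : Tree → Ser
Kbar = coeffP true

K : Tree → Ser
K = coeffP false

splits : Mon → List (Mon × Mon)
splits []      = [ ([] , []) ]
splits (e ∷ m) = concatMap (λ i → map (λ { (a , b) → (i ∷ a , (e ∸ i) ∷ b) }) (splits m)) (upTo (suc e))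

_⊛_ : Ser → Ser → Ser
(F ⊛ G) m = sum (map (λ { (a , b) → F a * G b }) (splits m))

oneS : Ser
oneS m = if allL (λ e → e ≡ᵇ 0) m then 1 else 0

prodS : List Ser → Ser
prodS = foldr _⊛_ oneS

-- shift S : x_i ↦ x_{i+1}
shiftS : Ser → Ser
shiftS F []          = F []
shiftS F (zero ∷ m)  = F m
shiftS F (suc _ ∷ m) = 0

shiftN : ℕ → Ser → Ser
shiftN zero    F = F
shiftN (suc k) F = shiftS (shiftN k F)

-- multiplication by x_{k+1}: coefficient of x^m in x_{k+1} G is the
-- coefficient of x^(m - e_{k+1}) in G (0 if m_{k+1} = 0)
mulX : ℕ → Ser → Ser
mulX k       G []          = 0
mulX zero    G (zero ∷ m)  = 0
mulX zero    G (suc e ∷ m) = G (e ∷ m)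
mulX (suc k) G (e ∷ m)     = mulX k (λ a → G (e ∷ a)) m

-- Λ̄ = Σ_{k≥1} x_k S^k,  Λ = Σ_{k≥1} x_k S^{k-1}.
-- At a monomial m only the terms with m_k ≥ 1, hence k ≤ length m,
-- can contribute; the (locally finite) sum is truncated accordingly.
Λbar : Ser → Ser
Λbar F m = sum (map (λ j → mulX j (shiftN (suc j) F) m) (upTo (length m)))

Λ : Ser → Ser
Λ F m = sum (map (λ j → mulX j (shiftN j F) m) (upTo (length m)))

-- A labelling of T (strict or weak, as for K̄ or K) is a label k for the root together with a
-- labelling of the forest T₁ ⊔ ⋯ ⊔ T_d all of whose labels exceed k (resp. are at least k).
-- Vertices of distinct Tᵢ are incomparable, so the forest labellings are counted by ∏ K(Tᵢ);
-- forcing every label above k shifts each variable x_i to x_{i+k} (resp. x_{i+k-1}), which is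
-- S^k (resp. S^{k-1}), and the root contributes the factor x_k. Summing over k gives Λ̄ (resp. Λ).
-- Labellings are enumerated as label vectors in preorder, so the root label comes first and the
-- labels of each Tᵢ occupy a consecutive block.

module Submission where

open import Defs
open import Data.Bool using (Bool; true; false; not; _∧_; _∨_; if_then_else_)
open import Data.Bool.Properties using (∧-assoc; ∧-zeroʳ; ∧-identityʳ)
open import Data.Bool.ListAction using (and) renaming (all to allL)
open import Data.Fin as Fin using (Fin; zero; suc; toℕ; _↑ˡ_; _↑ʳ_)
open import Data.Fin.Properties using (_≟_; splitAt-↑ˡ; splitAt-↑ʳ)
open import Data.List using (List; []; _∷_; map; concatMap; length; lookup; allFin; upTo; tabulate; zipWith; _++_)
open import Data.List.Properties using (map-tabulate; map-applyUpTo; map-upTo; tabulate-cong; length-tabulate)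
open import Data.Nat using (ℕ; zero; suc; _+_; _*_; _∸_; _≤_; _≤ᵇ_; _<ᵇ_; _≡ᵇ_; s≤s)
open import Data.Nat.ListAction using (sum)
open import Data.Nat.Properties
  using (+-assoc; +-identityʳ; *-identityˡ; *-zeroʳ; *-comm; *-distribˡ-+; n≤1+n; ≤-refl; suc-injective)
open import Data.Nat.Tactic.RingSolver using (solve-∀)
open import Data.Product using (_×_; _,_; proj₁; proj₂)
open import Data.Vec using (Vec; []; _∷_) renaming (_++_ to _++ᵛ_; map to mapᵛ)
open import Function using (_∘_; id)
open import Relation.Nullary.Decidable using (⌊_⌋; ⌊⌋-map′)
open import Relation.Binary.PropositionalEquality using (_≡_; refl; sym; trans; cong; cong₂; module ≡-Reasoning)
open ≡-Reasoning

private
  variable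
    A B C : Set

∑ : List A → (A → ℕ) → ℕ
∑ xs f = sum (map f xs)

syntax ∑ xs (λ x → e) = ∑[ x ∈ xs ] e

∑-cong : (xs : List A) {f g : A → ℕ} → (∀ x → f x ≡ g x) → ∑ xs f ≡ ∑ xs g
∑-cong []       f≗g = refl
∑-cong (x ∷ xs) f≗g = cong₂ _+_ (f≗g x) (∑-cong xs f≗g)

∑-zero : (xs : List A) {f : A → ℕ} → (∀ x → f x ≡ 0) → ∑ xs f ≡ 0
∑-zero []       f≗0 = refl
∑-zero (x ∷ xs) f≗0 = cong₂ _+_ (f≗0 x) (∑-zero xs f≗0)

∑-++ : (xs ys : List A) (f : A → ℕ) → ∑ (xs ++ ys) f ≡ ∑ xs f + ∑ ys f
∑-++ []       ys f = refl
∑-++ (x ∷ xs) ys f = trans (cong (f x +_) (∑-++ xs ys f)) (sym (+-assoc (f x) _ _))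

∑-+ : (xs : List A) (f g : A → ℕ) → ∑[ x ∈ xs ] (f x + g x) ≡ ∑ xs f + ∑ xs g
∑-+ []       f g = refl
∑-+ (x ∷ xs) f g = trans (cong (f x + g x +_) (∑-+ xs f g)) (interchange (f x) (g x) _ _)
  where
  interchange : ∀ a b c d → a + b + (c + d) ≡ a + c + (b + d)
  interchange = solve-∀

*-distribˡ-∑ : (c : ℕ) (xs : List A) (f : A → ℕ) → c * ∑ xs f ≡ ∑[ x ∈ xs ] (c * f x)
*-distribˡ-∑ c []       f = *-zeroʳ c
*-distribˡ-∑ c (x ∷ xs) f = trans (*-distribˡ-+ c (f x) _) (cong (c * f x +_) (*-distribˡ-∑ c xs f))

*-distribʳ-∑ : (c : ℕ) (xs : List A) (f : A → ℕ) → ∑ xs f * c ≡ ∑[ x ∈ xs ] (f x * c)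
*-distribʳ-∑ c xs f =
  trans (*-comm (∑ xs f) c) (trans (*-distribˡ-∑ c xs f) (∑-cong xs (λ x → *-comm c (f x))))

∑-comm : (xs : List A) (ys : List B) (f : A → B → ℕ) →
         ∑[ x ∈ xs ] ∑ ys (f x) ≡ ∑[ y ∈ ys ] ∑[ x ∈ xs ] f x y
∑-comm []       ys f = sym (∑-zero ys (λ _ → refl))
∑-comm (x ∷ xs) ys f =
  trans (cong (∑ ys (f x) +_) (∑-comm xs ys f)) (sym (∑-+ ys (f x) (λ y → ∑[ x ∈ xs ] f x y)))

∑-map : (h : B → A) (xs : List B) (f : A → ℕ) → ∑ (map h xs) f ≡ ∑ xs (f ∘ h)
∑-map h []       f = refl
∑-map h (x ∷ xs) f = cong (f (h x) +_) (∑-map h xs f)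

∑-concatMap : (h : B → List A) (xs : List B) (f : A → ℕ) →
              ∑ (concatMap h xs) f ≡ ∑[ x ∈ xs ] ∑ (h x) f
∑-concatMap h []       f = refl
∑-concatMap h (x ∷ xs) f =
  trans (∑-++ (h x) (concatMap h xs) f) (cong (∑ (h x) f +_) (∑-concatMap h xs f))

∑-tabulate : ∀ {n} (g : Fin n → A) (f : A → ℕ) → ∑ (tabulate g) f ≡ ∑ (allFin n) (f ∘ g)
∑-tabulate g f = cong sum (trans (map-tabulate g f) (sym (map-tabulate id (f ∘ g))))

∑-interchange-* : (xs : List A) (ys : List B) (zs : List C) (f : A → C → ℕ) (g : B → C → ℕ) →
                  ∑[ x ∈ xs ] ∑[ y ∈ ys ] ∑[ z ∈ zs ] (f x z * g y z)
                  ≡ ∑[ z ∈ zs ] (∑[ x ∈ xs ] f x z * ∑[ y ∈ ys ] g y z)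
∑-interchange-* xs ys zs f g = begin
  ∑[ x ∈ xs ] ∑[ y ∈ ys ] ∑[ z ∈ zs ] (f x z * g y z)
    ≡⟨ ∑-cong xs (λ x → ∑-comm ys zs _) ⟩
  ∑[ x ∈ xs ] ∑[ z ∈ zs ] ∑[ y ∈ ys ] (f x z * g y z)
    ≡⟨ ∑-comm xs zs _ ⟩
  ∑[ z ∈ zs ] ∑[ x ∈ xs ] ∑[ y ∈ ys ] (f x z * g y z)
    ≡⟨ ∑-cong zs (λ z → ∑-cong xs (λ x → sym (*-distribˡ-∑ (f x z) ys (λ y → g y z)))) ⟩
  ∑[ z ∈ zs ] ∑[ x ∈ xs ] (f x z * ∑[ y ∈ ys ] g y z)
    ≡⟨ ∑-cong zs (λ z → sym (*-distribʳ-∑ _ xs (λ x → f x z))) ⟩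
  ∑[ z ∈ zs ] (∑[ x ∈ xs ] f x z * ∑[ y ∈ ys ] g y z) ∎

∑-allFin-suc : ∀ n (f : Fin (suc n) → ℕ) → ∑ (allFin (suc n)) f ≡ f zero + ∑ (allFin n) (f ∘ suc)
∑-allFin-suc n f = cong (f zero +_) (∑-tabulate {n = n} suc f)

∑-upTo-suc : ∀ n (f : ℕ → ℕ) → ∑ (upTo (suc n)) f ≡ f 0 + ∑ (upTo n) (f ∘ suc)
∑-upTo-suc n f = cong (f 0 +_) (cong sum (trans (map-applyUpTo suc f n) (sym (map-upTo (f ∘ suc) n))))

∑-allFin-toℕ : ∀ n (f : ℕ → ℕ) → ∑ (allFin n) (f ∘ toℕ) ≡ ∑ (upTo n) f
∑-allFin-toℕ zero    f = refl
∑-allFin-toℕ (suc n) f =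
  trans (∑-allFin-suc n (f ∘ toℕ)) (trans (cong (f 0 +_) (∑-allFin-toℕ n (f ∘ suc))) (sym (∑-upTo-suc n f)))

⟦_⟧ : Bool → ℕ
⟦ b ⟧ = if b then 1 else 0

⟦∧⟧ : ∀ a b → ⟦ a ∧ b ⟧ ≡ ⟦ a ⟧ * ⟦ b ⟧
⟦∧⟧ true  b = sym (+-identityʳ _)
⟦∧⟧ false b = refl

countB≡∑ : (p : A → Bool) (xs : List A) → countB p xs ≡ ∑[ x ∈ xs ] ⟦ p x ⟧
countB≡∑ p []       = refl
countB≡∑ p (x ∷ xs) = cong (⟦ p x ⟧ +_) (countB≡∑ p xs)

all-cong : (xs : List A) {p q : A → Bool} → (∀ x → p x ≡ q x) → allL p xs ≡ allL q xs
all-cong []       p≗q = refl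
all-cong (x ∷ xs) p≗q = cong₂ _∧_ (p≗q x) (all-cong xs p≗q)

all-true : (xs : List A) {p : A → Bool} → (∀ x → p x ≡ true) → allL p xs ≡ true
all-true []       p≗true = refl
all-true (x ∷ xs) {p} p≗true = trans (cong (_∧ allL p xs) (p≗true x)) (all-true xs p≗true)

all-tabulate : ∀ {n} (g : Fin n → A) (p : A → Bool) → allL p (tabulate g) ≡ allL (p ∘ g) (allFin n)
all-tabulate g p = cong and (trans (map-tabulate g p) (sym (map-tabulate id (p ∘ g))))

all-allFin-suc : ∀ n (p : Fin (suc n) → Bool) → allL p (allFin (suc n)) ≡ p zero ∧ allL (p ∘ suc) (allFin n)
all-allFin-suc n p = cong (p zero ∧_) (all-tabulate {n = n} suc p)

all-allFin-+ : ∀ a b (p : Fin (a + b) → Bool) →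
               allL p (allFin (a + b)) ≡ allL (λ i → p (i ↑ˡ b)) (allFin a) ∧ allL (λ j → p (a ↑ʳ j)) (allFin b)
all-allFin-+ zero    b p = refl
all-allFin-+ (suc a) b p = begin
  allL p (allFin (suc (a + b)))
    ≡⟨ all-allFin-suc (a + b) p ⟩
  p zero ∧ allL (p ∘ suc) (allFin (a + b))
    ≡⟨ cong (p zero ∧_) (all-allFin-+ a b (p ∘ suc)) ⟩
  p zero ∧ (allL (λ i → p (suc (i ↑ˡ b))) (allFin a) ∧ allL (λ j → p (suc (a ↑ʳ j))) (allFin b))
    ≡⟨ sym (∧-assoc (p zero) _ _) ⟩
  (p zero ∧ allL (λ i → p (suc (i ↑ˡ b))) (allFin a)) ∧ allL (λ j → p (suc (a ↑ʳ j))) (allFin b)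
    ≡⟨ cong (_∧ allL (λ j → p (suc (a ↑ʳ j))) (allFin b)) (sym (all-allFin-suc a (λ i → p (i ↑ˡ b)))) ⟩
  allL (λ i → p (i ↑ˡ b)) (allFin (suc a)) ∧ allL (λ j → p (suc a ↑ʳ j)) (allFin b) ∎

∑-allVec-suc : ∀ L n (f : Vec (Fin L) (suc n) → ℕ) →
               ∑ (allVec L (suc n)) f ≡ ∑[ v ∈ allVec L n ] ∑[ k ∈ allFin L ] f (k ∷ v)
∑-allVec-suc L n f =
  trans (∑-concatMap _ (allVec L n) f) (∑-cong (allVec L n) (λ v → ∑-map (_∷ v) (allFin L) f))

∑-allVec-+ : ∀ L a b (f : Vec (Fin L) (a + b) → ℕ) →
             ∑ (allVec L (a + b)) f ≡ ∑[ σ ∈ allVec L a ] ∑[ τ ∈ allVec L b ] f (σ ++ᵛ τ)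
∑-allVec-+ L zero    b f = sym (+-identityʳ _)
∑-allVec-+ L (suc a) b f = begin
  ∑ (allVec L (suc (a + b))) f
    ≡⟨ ∑-allVec-suc L (a + b) f ⟩
  ∑[ v ∈ allVec L (a + b) ] ∑[ k ∈ allFin L ] f (k ∷ v)
    ≡⟨ ∑-allVec-+ L a b _ ⟩
  ∑[ σ ∈ allVec L a ] ∑[ τ ∈ allVec L b ] ∑[ k ∈ allFin L ] f (k ∷ σ ++ᵛ τ)
    ≡⟨ ∑-cong (allVec L a) (λ σ → ∑-comm (allVec L b) (allFin L) _) ⟩
  ∑[ σ ∈ allVec L a ] ∑[ k ∈ allFin L ] ∑[ τ ∈ allVec L b ] f (k ∷ σ ++ᵛ τ)
    ≡⟨ sym (∑-allVec-suc L a _) ⟩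
  ∑[ σ ∈ allVec L (suc a) ] ∑[ τ ∈ allVec L b ] f (σ ++ᵛ τ) ∎

all≥ : ∀ {L n} → ℕ → Vec (Fin L) n → Bool
all≥ l []      = true
all≥ l (k ∷ v) = (l ≤ᵇ toℕ k) ∧ all≥ l v

all≥-zero : ∀ {L n} (v : Vec (Fin L) n) → all≥ 0 v ≡ true
all≥-zero []      = refl
all≥-zero (k ∷ v) = all≥-zero v

all≥-∷-false : ∀ {L n} l (k : Fin L) (v : Vec (Fin L) n) → all≥ l v ≡ false → all≥ l (k ∷ v) ≡ false
all≥-∷-false l k v v≱l = trans (cong ((l ≤ᵇ toℕ k) ∧_) v≱l) (∧-zeroʳ _)

all≥-suc-false : ∀ {L n} l (v : Vec (Fin L) n) → all≥ 1 v ≡ false → all≥ (suc l) v ≡ false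
all≥-suc-false l (zero  ∷ v) v≱1 = refl
all≥-suc-false l (suc k ∷ v) v≱1 = all≥-∷-false (suc l) (suc k) v (all≥-suc-false l v v≱1)

≤ᵇ-suc : ∀ a b → (suc a ≤ᵇ suc b) ≡ (a ≤ᵇ b)
≤ᵇ-suc zero    b = refl
≤ᵇ-suc (suc a) b = refl

all≥-map-suc : ∀ {L n} l (v : Vec (Fin L) n) → all≥ (suc l) (mapᵛ suc v) ≡ all≥ l v
all≥-map-suc l []      = refl
all≥-map-suc l (k ∷ v) = cong₂ _∧_ (≤ᵇ-suc l (toℕ k)) (all≥-map-suc l v)

all-lookup≥ : ∀ {L n} l (v : Vec (Fin L) n) → allL (λ j → l ≤ᵇ toℕ (lookupV v j)) (allFin n) ≡ all≥ l v
all-lookup≥ l []      = refl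
all-lookup≥ {n = suc n} l (k ∷ v) =
  trans (all-allFin-suc n (λ j → l ≤ᵇ toℕ (lookupV (k ∷ v) j))) (cong ((l ≤ᵇ toℕ k) ∧_) (all-lookup≥ l v))

∑-allVec-positive : ∀ L n (g : Vec (Fin (suc L)) n → ℕ) → (∀ v → all≥ 1 v ≡ false → g v ≡ 0) →
                    ∑ (allVec (suc L) n) g ≡ ∑[ v ∈ allVec L n ] g (mapᵛ suc v)
∑-allVec-positive L zero    g g≡0 = refl
∑-allVec-positive L (suc n) g g≡0 = begin
  ∑ (allVec (suc L) (suc n)) g
    ≡⟨ ∑-allVec-suc (suc L) n g ⟩
  ∑[ v ∈ allVec (suc L) n ] ∑[ k ∈ allFin (suc L) ] g (k ∷ v)
    ≡⟨ ∑-allVec-positive L n _ (λ v v≱1 → ∑-zero (allFin (suc L)) (λ k → g≡0 (k ∷ v) (all≥-∷-false 1 k v v≱1))) ⟩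
  ∑[ v ∈ allVec L n ] ∑[ k ∈ allFin (suc L) ] g (k ∷ mapᵛ suc v)
    ≡⟨ ∑-cong (allVec L n) (λ v → trans (∑-allFin-suc L (λ k → g (k ∷ mapᵛ suc v)))
                                          (cong (_+ ∑[ k ∈ allFin L ] g (suc k ∷ mapᵛ suc v)) (g≡0 (zero ∷ mapᵛ suc v) refl))) ⟩
  ∑[ v ∈ allVec L n ] ∑[ k ∈ allFin L ] g (suc k ∷ mapᵛ suc v)
    ≡⟨ sym (∑-allVec-suc L n _) ⟩
  ∑[ v ∈ allVec L (suc n) ] g (mapᵛ suc v) ∎

∑-all≥-suc : ∀ L n l (Q : Vec (Fin (suc L)) n → Bool) →
             ∑[ τ ∈ allVec (suc L) n ] ⟦ all≥ (suc l) τ ∧ Q τ ⟧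
             ≡ ∑[ τ ∈ allVec L n ] ⟦ all≥ l τ ∧ Q (mapᵛ suc τ) ⟧
∑-all≥-suc L n l Q = trans
  (∑-allVec-positive L n _ (λ τ τ≱1 → cong (λ b → ⟦ b ∧ Q τ ⟧) (all≥-suc-false l τ τ≱1)))
  (∑-cong (allVec L n) (λ τ → cong (λ b → ⟦ b ∧ Q (mapᵛ suc τ) ⟧) (all≥-map-suc l τ)))

weight : ∀ {L n} → Vec (Fin L) n → Mon
weight {L} σ = tabulate {n = L} (λ k → occ k σ)

infix 4 _==_

_==_ : List ℕ → List ℕ → Bool
[]       == []       = true
[]       == (_ ∷ _)  = false
(_ ∷ _)  == []       = false
(x ∷ xs) == (y ∷ ys) = (x ≡ᵇ y) ∧ (xs == ys)

all-≡ᵇ-lookup : ∀ m (g : Fin (length m) → ℕ) →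
                allL (λ k → g k ≡ᵇ lookup m k) (allFin (length m)) ≡ (tabulate g == m)
all-≡ᵇ-lookup []      g = refl
all-≡ᵇ-lookup (e ∷ m) g =
  trans (all-allFin-suc (length m) (λ k → g k ≡ᵇ lookup (e ∷ m) k))
        (cong ((g zero ≡ᵇ e) ∧_) (all-≡ᵇ-lookup m (g ∘ suc)))

occ-++ : ∀ {L a b} (k : Fin L) (σ : Vec (Fin L) a) (τ : Vec (Fin L) b) → occ k (σ ++ᵛ τ) ≡ occ k σ + occ k τ
occ-++ k []      τ = refl
occ-++ k (x ∷ σ) τ = trans (cong (⟦ ⌊ x ≟ k ⌋ ⟧ +_) (occ-++ k σ τ)) (sym (+-assoc ⟦ ⌊ x ≟ k ⌋ ⟧ _ _))

tabulate-+ : ∀ n (f g : Fin n → ℕ) → tabulate (λ k → f k + g k) ≡ zipWith _+_ (tabulate f) (tabulate g)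
tabulate-+ zero    f g = refl
tabulate-+ (suc n) f g = cong (f zero + g zero ∷_) (tabulate-+ n (f ∘ suc) (g ∘ suc))

weight-++ : ∀ {L a b} (σ : Vec (Fin L) a) (τ : Vec (Fin L) b) → weight (σ ++ᵛ τ) ≡ zipWith _+_ (weight σ) (weight τ)
weight-++ {L} σ τ = trans (tabulate-cong (λ k → occ-++ k σ τ)) (tabulate-+ L _ _)

occ-zero-map-suc : ∀ {L n} (τ : Vec (Fin L) n) → occ zero (mapᵛ suc τ) ≡ 0
occ-zero-map-suc []      = refl
occ-zero-map-suc (k ∷ τ) = occ-zero-map-suc τ

occ-suc-map-suc : ∀ {L n} (i : Fin L) (τ : Vec (Fin L) n) → occ (suc i) (mapᵛ suc τ) ≡ occ i τ
occ-suc-map-suc i []      = refl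
occ-suc-map-suc i (k ∷ τ) = cong₂ _+_ (cong ⟦_⟧ (⌊⌋-map′ _ _ (k ≟ i))) (occ-suc-map-suc i τ)

weight-map-suc : ∀ {L n} (τ : Vec (Fin L) n) → weight (mapᵛ suc τ) ≡ 0 ∷ weight τ
weight-map-suc τ = cong₂ _∷_ (occ-zero-map-suc τ) (tabulate-cong (λ i → occ-suc-map-suc i τ))

occ-zero-all≥ : ∀ {L n} l (τ : Vec (Fin (suc L)) n) → all≥ (suc l) τ ≡ true → occ zero τ ≡ 0
occ-zero-all≥ l []          τ≥ = refl
occ-zero-all≥ l (suc k ∷ τ) τ≥ = occ-zero-all≥ l τ (∧-true-right (l <ᵇ suc (toℕ k)) τ≥)
  where
  ∧-true-right : ∀ a {b} → a ∧ b ≡ true → b ≡ true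
  ∧-true-right true b≡true = b≡true

∑-splits-∷ : ∀ e m (f : Mon × Mon → ℕ) →
             ∑ (splits (e ∷ m)) f ≡ ∑[ i ∈ upTo (suc e) ] ∑[ p ∈ splits m ] f (i ∷ proj₁ p , (e ∸ i) ∷ proj₂ p)
∑-splits-∷ e m f = trans (∑-concatMap (λ i → map (prepend i) (splits m)) (upTo (suc e)) f)
                         (∑-cong (upTo (suc e)) (λ i → ∑-map (prepend i) (splits m) f))
  where
  prepend : ℕ → Mon × Mon → Mon × Mon
  prepend i p = (i ∷ proj₁ p , (e ∸ i) ∷ proj₂ p)

∑-splits-cong : ∀ m {f g : Mon × Mon → ℕ} →
                (∀ a b → length a ≡ length m → length b ≡ length m → f (a , b) ≡ g (a , b)) →
                ∑ (splits m) f ≡ ∑ (splits m) g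
∑-splits-cong []      f≗g = cong (_+ 0) (f≗g [] [] refl refl)
∑-splits-cong (e ∷ m) {f} {g} f≗g = begin
  ∑ (splits (e ∷ m)) f
    ≡⟨ ∑-splits-∷ e m f ⟩
  ∑[ i ∈ upTo (suc e) ] ∑[ p ∈ splits m ] f (i ∷ proj₁ p , (e ∸ i) ∷ proj₂ p)
    ≡⟨ ∑-cong (upTo (suc e)) (λ i → ∑-splits-cong m (λ a b ∣a∣ ∣b∣ →
                                       f≗g (i ∷ a) ((e ∸ i) ∷ b) (cong suc ∣a∣) (cong suc ∣b∣))) ⟩
  ∑[ i ∈ upTo (suc e) ] ∑[ p ∈ splits m ] g (i ∷ proj₁ p , (e ∸ i) ∷ proj₂ p)
    ≡⟨ sym (∑-splits-∷ e m g) ⟩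
  ∑ (splits (e ∷ m)) g ∎

∑-antidiagonal-indicator : ∀ e x y → ∑[ i ∈ upTo (suc e) ] (⟦ x ≡ᵇ i ⟧ * ⟦ y ≡ᵇ e ∸ i ⟧) ≡ ⟦ x + y ≡ᵇ e ⟧
∑-antidiagonal-indicator zero    zero    zero    = refl
∑-antidiagonal-indicator zero    zero    (suc y) = refl
∑-antidiagonal-indicator zero    (suc x) y       = refl
∑-antidiagonal-indicator (suc e) zero    y       =
  trans (∑-upTo-suc (suc e) (λ i → ⟦ 0 ≡ᵇ i ⟧ * ⟦ y ≡ᵇ suc e ∸ i ⟧))
        (trans (cong₂ _+_ (*-identityˡ _) (∑-zero (upTo (suc e)) (λ _ → refl))) (+-identityʳ _))
∑-antidiagonal-indicator (suc e) (suc x) y       =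
  trans (∑-upTo-suc (suc e) (λ i → ⟦ suc x ≡ᵇ i ⟧ * ⟦ y ≡ᵇ suc e ∸ i ⟧)) (∑-antidiagonal-indicator e x y)

∑-splits-indicator : ∀ m u v → length u ≡ length m → length v ≡ length m →
                     ∑[ p ∈ splits m ] (⟦ u == proj₁ p ⟧ * ⟦ v == proj₂ p ⟧) ≡ ⟦ zipWith _+_ u v == m ⟧
∑-splits-indicator []      []      []      ∣u∣ ∣v∣ = refl
∑-splits-indicator (e ∷ m) (x ∷ u) (y ∷ v) ∣u∣ ∣v∣ = begin
  ∑[ p ∈ splits (e ∷ m) ] (⟦ x ∷ u == proj₁ p ⟧ * ⟦ y ∷ v == proj₂ p ⟧)
    ≡⟨ ∑-splits-∷ e m _ ⟩
  ∑[ i ∈ upTo (suc e) ] ∑[ p ∈ splits m ] (⟦ (x ≡ᵇ i) ∧ (u == proj₁ p) ⟧ * ⟦ (y ≡ᵇ e ∸ i) ∧ (v == proj₂ p) ⟧)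
    ≡⟨ ∑-cong (upTo (suc e)) (λ i → ∑-cong (splits m) (λ p →
         separate (x ≡ᵇ i) (u == proj₁ p) (y ≡ᵇ e ∸ i) (v == proj₂ p))) ⟩
  ∑[ i ∈ upTo (suc e) ] ∑[ p ∈ splits m ] (⟦ x ≡ᵇ i ⟧ * ⟦ y ≡ᵇ e ∸ i ⟧ * (⟦ u == proj₁ p ⟧ * ⟦ v == proj₂ p ⟧))
    ≡⟨ ∑-cong (upTo (suc e)) (λ i → sym (*-distribˡ-∑ (⟦ x ≡ᵇ i ⟧ * ⟦ y ≡ᵇ e ∸ i ⟧) (splits m) _)) ⟩
  ∑[ i ∈ upTo (suc e) ] (⟦ x ≡ᵇ i ⟧ * ⟦ y ≡ᵇ e ∸ i ⟧ * ∑[ p ∈ splits m ] (⟦ u == proj₁ p ⟧ * ⟦ v == proj₂ p ⟧))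
    ≡⟨ ∑-cong (upTo (suc e)) (λ i → cong (⟦ x ≡ᵇ i ⟧ * ⟦ y ≡ᵇ e ∸ i ⟧ *_)
                                        (∑-splits-indicator m u v (suc-injective ∣u∣) (suc-injective ∣v∣))) ⟩
  ∑[ i ∈ upTo (suc e) ] (⟦ x ≡ᵇ i ⟧ * ⟦ y ≡ᵇ e ∸ i ⟧ * ⟦ zipWith _+_ u v == m ⟧)
    ≡⟨ sym (*-distribʳ-∑ _ (upTo (suc e)) (λ i → ⟦ x ≡ᵇ i ⟧ * ⟦ y ≡ᵇ e ∸ i ⟧)) ⟩
  ∑[ i ∈ upTo (suc e) ] (⟦ x ≡ᵇ i ⟧ * ⟦ y ≡ᵇ e ∸ i ⟧) * ⟦ zipWith _+_ u v == m ⟧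
    ≡⟨ cong (_* ⟦ zipWith _+_ u v == m ⟧) (∑-antidiagonal-indicator e x y) ⟩
  ⟦ x + y ≡ᵇ e ⟧ * ⟦ zipWith _+_ u v == m ⟧
    ≡⟨ sym (⟦∧⟧ (x + y ≡ᵇ e) _) ⟩
  ⟦ zipWith _+_ (x ∷ u) (y ∷ v) == e ∷ m ⟧ ∎
  where
  separate : ∀ a b c d → ⟦ a ∧ b ⟧ * ⟦ c ∧ d ⟧ ≡ ⟦ a ⟧ * ⟦ c ⟧ * (⟦ b ⟧ * ⟦ d ⟧)
  separate a b c d = trans (cong₂ _*_ (⟦∧⟧ a b) (⟦∧⟧ c d)) (interchange ⟦ a ⟧ ⟦ b ⟧ ⟦ c ⟧ ⟦ d ⟧)
    where
    interchange : ∀ a b c d → a * b * (c * d) ≡ a * c * (b * d)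
    interchange = solve-∀

-- The order condition

cmp : Bool → ℕ → ℕ → Bool
cmp strict a b = if strict then a <ᵇ b else a ≤ᵇ b

respects : ∀ {n L} → Bool → (Fin n → Fin n → Bool) → Vec (Fin L) n → Fin n → Fin n → Bool
respects strict _<_ σ y x = not (y < x) ∨ cmp strict (toℕ (lookupV σ y)) (toℕ (lookupV σ x))

orderOK : ∀ {n L} → Bool → (Fin n → Fin n → Bool) → Vec (Fin L) n → Bool
orderOK {n} strict _<_ σ = allL (λ y → allL (respects strict _<_ σ y) (allFin n)) (allFin n)

orderOK-map-suc : ∀ {n L} strict (_<_ : Fin n → Fin n → Bool) (σ : Vec (Fin L) n) →
                  orderOK strict _<_ (mapᵛ suc σ) ≡ orderOK strict _<_ σ
orderOK-map-suc {n} strict _<_ σ = all-cong (allFin n) (λ y → all-cong (allFin n) (λ x →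
  cong (not (y < x) ∨_) (trans (cong₂ (λ a b → cmp strict (toℕ a) (toℕ b)) (lookupV-map-suc σ y) (lookupV-map-suc σ x))
                               (cmp-suc strict (toℕ (lookupV σ y)) (toℕ (lookupV σ x))))))
  where
  lookupV-map-suc : ∀ {n L} (σ : Vec (Fin L) n) i → lookupV (mapᵛ (Fin.suc {L}) σ) i ≡ suc (lookupV σ i)
  lookupV-map-suc (k ∷ σ) zero    = refl
  lookupV-map-suc (k ∷ σ) (suc i) = lookupV-map-suc σ i
  cmp-suc : ∀ strict a b → cmp strict (suc a) (suc b) ≡ cmp strict a b
  cmp-suc true  a b = refl
  cmp-suc false a b = ≤ᵇ-suc a b

lookupV-++-↑ˡ : ∀ {a b} (σ : Vec A a) (τ : Vec A b) i → lookupV (σ ++ᵛ τ) (i ↑ˡ b) ≡ lookupV σ i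
lookupV-++-↑ˡ (x ∷ σ) τ zero    = refl
lookupV-++-↑ˡ (x ∷ σ) τ (suc i) = lookupV-++-↑ˡ σ τ i

lookupV-++-↑ʳ : ∀ {a b} (σ : Vec A a) (τ : Vec A b) j → lookupV (σ ++ᵛ τ) (a ↑ʳ j) ≡ lookupV τ j
lookupV-++-↑ʳ []      τ j = refl
lookupV-++-↑ʳ (x ∷ σ) τ j = lookupV-++-↑ʳ σ τ j

module _ (t : Tree) (ts : List Tree) where

  ltF-↑ˡ-↑ˡ : ∀ i j → ltF (t ∷ ts) (i ↑ˡ sizeF ts) (j ↑ˡ sizeF ts) ≡ ltT t i j
  ltF-↑ˡ-↑ˡ i j rewrite splitAt-↑ˡ (size t) i (sizeF ts) | splitAt-↑ˡ (size t) j (sizeF ts) = refl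

  ltF-↑ˡ-↑ʳ : ∀ i j → ltF (t ∷ ts) (i ↑ˡ sizeF ts) (size t ↑ʳ j) ≡ false
  ltF-↑ˡ-↑ʳ i j rewrite splitAt-↑ˡ (size t) i (sizeF ts) | splitAt-↑ʳ (size t) (sizeF ts) j = refl

  ltF-↑ʳ-↑ˡ : ∀ i j → ltF (t ∷ ts) (size t ↑ʳ i) (j ↑ˡ sizeF ts) ≡ false
  ltF-↑ʳ-↑ˡ i j rewrite splitAt-↑ʳ (size t) (sizeF ts) i | splitAt-↑ˡ (size t) j (sizeF ts) = refl

  ltF-↑ʳ-↑ʳ : ∀ i j → ltF (t ∷ ts) (size t ↑ʳ i) (size t ↑ʳ j) ≡ ltF ts i j
  ltF-↑ʳ-↑ʳ i j rewrite splitAt-↑ʳ (size t) (sizeF ts) i | splitAt-↑ʳ (size t) (sizeF ts) j = refl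

  orderOK-∷ : ∀ {L} strict (σ : Vec (Fin L) (size t)) (τ : Vec (Fin L) (sizeF ts)) →
              orderOK strict (ltF (t ∷ ts)) (σ ++ᵛ τ) ≡ orderOK strict (ltT t) σ ∧ orderOK strict (ltF ts) τ
  orderOK-∷ {L} strict σ τ = trans (all-allFin-+ a b _) (cong₂ _∧_ (all-cong (allFin a) rowˡ) (all-cong (allFin b) rowʳ))
    where
    a = size t
    b = sizeF ts
    ok : Fin (a + b) → Fin (a + b) → Bool
    ok = respects strict (ltF (t ∷ ts)) (σ ++ᵛ τ)
    cmp-cong : ∀ {u v u′ v′ : Fin L} → u ≡ u′ → v ≡ v′ → cmp strict (toℕ u) (toℕ v) ≡ cmp strict (toℕ u′) (toℕ v′)
    cmp-cong = cong₂ (λ u v → cmp strict (toℕ u) (toℕ v))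
    unrelated : ∀ y x → ltF (t ∷ ts) y x ≡ false → ok y x ≡ true
    unrelated y x y≮x = cong (λ lt → not lt ∨ cmp strict (toℕ (lookupV (σ ++ᵛ τ) y)) (toℕ (lookupV (σ ++ᵛ τ) x))) y≮x
    rowˡ : ∀ i → allL (ok (i ↑ˡ b)) (allFin (a + b)) ≡ allL (respects strict (ltT t) σ i) (allFin a)
    rowˡ i = trans (all-allFin-+ a b _) (trans (cong₂ _∧_
      (all-cong (allFin a) (λ j → cong₂ _∨_ (cong not (ltF-↑ˡ-↑ˡ i j)) (cmp-cong (lookupV-++-↑ˡ σ τ i) (lookupV-++-↑ˡ σ τ j))))
      (all-true (allFin b) (λ j → unrelated (i ↑ˡ b) (a ↑ʳ j) (ltF-↑ˡ-↑ʳ i j)))) (∧-identityʳ _))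
    rowʳ : ∀ i → allL (ok (a ↑ʳ i)) (allFin (a + b)) ≡ allL (respects strict (ltF ts) τ i) (allFin b)
    rowʳ i = trans (all-allFin-+ a b _) (cong₂ _∧_
      (all-true (allFin a) (λ j → unrelated (a ↑ʳ i) (j ↑ˡ b) (ltF-↑ʳ-↑ˡ i j)))
      (all-cong (allFin b) (λ j → cong₂ _∨_ (cong not (ltF-↑ʳ-↑ʳ i j)) (cmp-cong (lookupV-++-↑ʳ σ τ i) (lookupV-++-↑ʳ σ τ j)))))

-- The least label a strict descendant of a vertex labelled j may carry (j + 1 for K̄, j for K).
next : Bool → ℕ → ℕ
next true  j = suc j
next false j = j

orderOK-node : ∀ {L} strict ts (k : Fin L) (τ : Vec (Fin L) (sizeF ts)) →
               orderOK strict (ltT (node ts)) (k ∷ τ) ≡ all≥ (next strict (toℕ k)) τ ∧ orderOK strict (ltF ts) τ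
orderOK-node strict ts k τ = begin
  allL (λ y → allL (row y) (allFin (suc n))) (allFin (suc n))
    ≡⟨ all-allFin-suc n (λ y → allL (row y) (allFin (suc n))) ⟩
  allL (row zero) (allFin (suc n)) ∧ allL (λ i → allL (row (suc i)) (allFin (suc n))) (allFin n)
    ≡⟨ cong₂ _∧_ rootRow (all-cong (allFin n) (λ i → all-allFin-suc n (row (suc i)))) ⟩
  all≥ (next strict (toℕ k)) τ ∧ orderOK strict (ltF ts) τ ∎
  where
  n = sizeF ts
  row : Fin (suc n) → Fin (suc n) → Bool
  row = respects strict (ltT (node ts)) (k ∷ τ)
  cmp-next : ∀ strict j x → cmp strict j x ≡ (next strict j ≤ᵇ x)
  cmp-next true  j x = refl
  cmp-next false j x = refl
  rootRow : allL (row zero) (allFin (suc n)) ≡ all≥ (next strict (toℕ k)) τ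
  rootRow = trans (all-allFin-suc n (row zero))
                  (trans (all-cong (allFin n) (λ j → cmp-next strict (toℕ k) (toℕ (lookupV τ j))))
                         (all-lookup≥ (next strict (toℕ k)) τ))

-- Forests

labelled : ∀ {n L} → Bool → (Fin n → Fin n → Bool) → Vec (Fin L) n → Mon → ℕ
labelled strict _<_ σ a = ⟦ orderOK strict _<_ σ ⟧ * ⟦ weight σ == a ⟧

labellings : ∀ {n} → Bool → (Fin n → Fin n → Bool) → ℕ → Mon → ℕ
labellings {n} strict _<_ L a = ∑[ σ ∈ allVec L n ] labelled strict _<_ σ a

coeffP≡labellings : ∀ strict t a → coeffP strict t a ≡ labellings strict (ltT t) (length a) a
coeffP≡labellings strict t a = trans (countB≡∑ _ (allVec (length a) (size t))) (∑-cong (allVec (length a) (size t)) (λ σ →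
  trans (⟦∧⟧ (orderOK strict (ltT t) σ) _)
        (cong (λ w → ⟦ orderOK strict (ltT t) σ ⟧ * ⟦ w ⟧) (all-≡ᵇ-lookup a (λ k → occ k σ)))))

zeros== : ∀ m → (tabulate {n = length m} (λ _ → 0) == m) ≡ allL (_≡ᵇ 0) m
zeros== []          = refl
zeros== (zero ∷ m)  = zeros== m
zeros== (suc e ∷ m) = refl

labelled-++ : ∀ strict t ts m (σ : Vec (Fin (length m)) (size t)) (τ : Vec (Fin (length m)) (sizeF ts)) →
              labelled strict (ltF (t ∷ ts)) (σ ++ᵛ τ) m
              ≡ ∑[ p ∈ splits m ] (labelled strict (ltT t) σ (proj₁ p) * labelled strict (ltF ts) τ (proj₂ p))
labelled-++ strict t ts m σ τ = begin
  ⟦ orderOK strict (ltF (t ∷ ts)) (σ ++ᵛ τ) ⟧ * ⟦ weight (σ ++ᵛ τ) == m ⟧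
    ≡⟨ cong₂ _*_ (trans (cong ⟦_⟧ (orderOK-∷ t ts strict σ τ)) (⟦∧⟧ ok₁ ok₂)) (cong (λ w → ⟦ w == m ⟧) (weight-++ σ τ)) ⟩
  ⟦ ok₁ ⟧ * ⟦ ok₂ ⟧ * ⟦ zipWith _+_ (weight σ) (weight τ) == m ⟧
    ≡⟨ cong (⟦ ok₁ ⟧ * ⟦ ok₂ ⟧ *_)
            (sym (∑-splits-indicator m (weight σ) (weight τ) (length-tabulate _) (length-tabulate _))) ⟩
  ⟦ ok₁ ⟧ * ⟦ ok₂ ⟧ * ∑[ p ∈ splits m ] (⟦ weight σ == proj₁ p ⟧ * ⟦ weight τ == proj₂ p ⟧)
    ≡⟨ *-distribˡ-∑ (⟦ ok₁ ⟧ * ⟦ ok₂ ⟧) (splits m) _ ⟩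
  ∑[ p ∈ splits m ] (⟦ ok₁ ⟧ * ⟦ ok₂ ⟧ * (⟦ weight σ == proj₁ p ⟧ * ⟦ weight τ == proj₂ p ⟧))
    ≡⟨ ∑-cong (splits m) (λ p → interchange ⟦ ok₁ ⟧ ⟦ ok₂ ⟧ ⟦ weight σ == proj₁ p ⟧ ⟦ weight τ == proj₂ p ⟧) ⟩
  ∑[ p ∈ splits m ] (labelled strict (ltT t) σ (proj₁ p) * labelled strict (ltF ts) τ (proj₂ p)) ∎
  where
  ok₁ = orderOK strict (ltT t) σ
  ok₂ = orderOK strict (ltF ts) τ
  interchange : ∀ a b c d → a * b * (c * d) ≡ a * c * (b * d)
  interchange = solve-∀

-- K(T₁ ⊔ ⋯ ⊔ T_d) = ∏ K(Tᵢ), since vertices of distinct trees are incomparable.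
labellings-forest : ∀ strict ts m → labellings strict (ltF ts) (length m) m ≡ prodS (map (coeffP strict) ts) m
labellings-forest strict []       m = trans (+-identityʳ _) (trans (*-identityˡ _) (cong ⟦_⟧ (zeros== m)))
labellings-forest strict (t ∷ ts) m = begin
  labellings strict (ltF (t ∷ ts)) L m
    ≡⟨ ∑-allVec-+ L (size t) (sizeF ts) _ ⟩
  ∑[ σ ∈ allVec L (size t) ] ∑[ τ ∈ allVec L (sizeF ts) ] labelled strict (ltF (t ∷ ts)) (σ ++ᵛ τ) m
    ≡⟨ ∑-cong (allVec L (size t)) (λ σ → ∑-cong (allVec L (sizeF ts)) (labelled-++ strict t ts m σ)) ⟩
  ∑[ σ ∈ allVec L (size t) ] ∑[ τ ∈ allVec L (sizeF ts) ] ∑[ p ∈ splits m ]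
     (labelled strict (ltT t) σ (proj₁ p) * labelled strict (ltF ts) τ (proj₂ p))
    ≡⟨ ∑-interchange-* (allVec L (size t)) (allVec L (sizeF ts)) (splits m) _ _ ⟩
  ∑[ p ∈ splits m ] (labellings strict (ltT t) L (proj₁ p) * labellings strict (ltF ts) L (proj₂ p))
    ≡⟨ ∑-splits-cong m (λ a b ∣a∣ ∣b∣ → cong₂ _*_
         (sym (trans (coeffP≡labellings strict t a) (cong (λ L′ → labellings strict (ltT t) L′ a) ∣a∣)))
         (trans (cong (λ L′ → labellings strict (ltF ts) L′ b) (sym ∣b∣)) (labellings-forest strict ts b))) ⟩
  ∑[ p ∈ splits m ] (coeffP strict t (proj₁ p) * prodS (map (coeffP strict) ts) (proj₂ p)) ∎
  where
  L = length m

-- The root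

shiftS-cong : ∀ {F G : Ser} → (∀ a → F a ≡ G a) → ∀ m → shiftS F m ≡ shiftS G m
shiftS-cong F≗G []          = F≗G []
shiftS-cong F≗G (zero ∷ m)  = F≗G m
shiftS-cong F≗G (suc _ ∷ m) = refl

shiftN-cong : ∀ k {F G : Ser} → (∀ a → F a ≡ G a) → ∀ m → shiftN k F m ≡ shiftN k G m
shiftN-cong zero    F≗G = F≗G
shiftN-cong (suc k) F≗G = shiftS-cong (shiftN-cong k F≗G)

mulX-cong : ∀ k {F G : Ser} → (∀ a → F a ≡ G a) → ∀ m → mulX k F m ≡ mulX k G m
mulX-cong k       F≗G []          = refl
mulX-cong zero    F≗G (zero ∷ m)  = refl
mulX-cong zero    F≗G (suc e ∷ m) = F≗G (e ∷ m)
mulX-cong (suc k) F≗G (e ∷ m)     = mulX-cong k (λ a → F≗G (e ∷ a)) m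

mulX-zero : ∀ k m → mulX k (λ _ → 0) m ≡ 0
mulX-zero k       []          = refl
mulX-zero zero    (zero ∷ m)  = refl
mulX-zero zero    (suc e ∷ m) = refl
mulX-zero (suc k) (e ∷ m)     = mulX-zero k m

∧-∧-false : ∀ a b → a ∧ b ∧ false ≡ false
∧-∧-false a b = trans (cong (a ∧_) (∧-zeroʳ b)) (∧-zeroʳ a)

-- For P the order condition of a forest, above l is the series of its labellings by labels ≥ l,
-- and withRoot m k l counts labellings of the tree obtained by adding a root labelled k.
module LabelsAbove (n : ℕ) (P : ∀ {L} → Vec (Fin L) n → Bool)
                   (P-map-suc : ∀ {L} (τ : Vec (Fin L) n) → P (mapᵛ suc τ) ≡ P τ) where

  above : ℕ → Ser
  above l m = ∑[ τ ∈ allVec (length m) n ] ⟦ all≥ l τ ∧ P τ ∧ (weight τ == m) ⟧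

  withRoot : (m : Mon) → Fin (length m) → ℕ → ℕ
  withRoot m k l = ∑[ τ ∈ allVec (length m) n ] ⟦ all≥ l τ ∧ P τ ∧ (weight (k ∷ τ) == m) ⟧

  above-suc : ∀ l m → above (suc l) m ≡ shiftS (above l) m
  above-suc l []          = ∑-cong (allVec 0 n) (λ τ → cong (λ b → ⟦ b ∧ P τ ∧ (weight τ == []) ⟧) (no-labels τ))
    where
    no-labels : ∀ {n} (τ : Vec (Fin 0) n) → all≥ (suc l) τ ≡ all≥ l τ
    no-labels [] = refl
  above-suc l (zero ∷ m)  = begin
    ∑[ τ ∈ allVec (suc (length m)) n ] ⟦ all≥ (suc l) τ ∧ P τ ∧ (weight τ == zero ∷ m) ⟧
      ≡⟨ ∑-all≥-suc (length m) n l (λ τ → P τ ∧ (weight τ == zero ∷ m)) ⟩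
    ∑[ τ ∈ allVec (length m) n ] ⟦ all≥ l τ ∧ P (mapᵛ suc τ) ∧ (weight (mapᵛ suc τ) == zero ∷ m) ⟧
      ≡⟨ ∑-cong (allVec (length m) n) (λ τ → cong (λ b → ⟦ all≥ l τ ∧ b ⟧)
                                         (cong₂ _∧_ (P-map-suc τ) (cong (_== zero ∷ m) (weight-map-suc τ)))) ⟩
    above l m ∎
  above-suc l (suc e ∷ m) = ∑-zero (allVec (suc (length m)) n) vanishes
    where
    vanishes : ∀ τ → ⟦ all≥ (suc l) τ ∧ P τ ∧ (weight τ == suc e ∷ m) ⟧ ≡ 0
    vanishes τ with all≥ (suc l) τ in τ≥
    ... | false = refl
    ... | true rewrite occ-zero-all≥ l τ τ≥ | ∧-zeroʳ (P τ) = refl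

  above≡shiftN : ∀ l m → above l m ≡ shiftN l (above 0) m
  above≡shiftN zero    m = refl
  above≡shiftN (suc l) m = trans (above-suc l m) (shiftS-cong (above≡shiftN l) m)

  withRoot≡mulX : ∀ m (k : Fin (length m)) l → toℕ k ≤ l → withRoot m k l ≡ mulX (toℕ k) (above l) m
  withRoot≡mulX (zero ∷ m)  zero    l     _       =
    ∑-zero (allVec (suc (length m)) n) (λ τ → cong ⟦_⟧ (∧-∧-false (all≥ l τ) (P τ)))
  withRoot≡mulX (suc e ∷ m) zero    l     _       = refl
  -- The root label and all labels of τ exceed the least one: lower every label by one.
  withRoot≡mulX (e ∷ m)     (suc k) (suc l) (s≤s k≤l) = begin
    ∑[ τ ∈ allVec (suc (length m)) n ] ⟦ all≥ (suc l) τ ∧ P τ ∧ (weight (suc k ∷ τ) == e ∷ m) ⟧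
      ≡⟨ ∑-all≥-suc (length m) n l (λ τ → P τ ∧ (weight (suc k ∷ τ) == e ∷ m)) ⟩
    ∑[ τ ∈ allVec (length m) n ] ⟦ all≥ l τ ∧ P (mapᵛ suc τ) ∧ (weight (mapᵛ suc (k ∷ τ)) == e ∷ m) ⟧
      ≡⟨ ∑-cong (allVec (length m) n) (λ τ → cong (λ b → ⟦ all≥ l τ ∧ b ⟧)
                                         (cong₂ _∧_ (P-map-suc τ) (cong (_== e ∷ m) (weight-map-suc (k ∷ τ))))) ⟩
    ∑[ τ ∈ allVec (length m) n ] ⟦ all≥ l τ ∧ P τ ∧ ((0 ≡ᵇ e) ∧ (weight (k ∷ τ) == m)) ⟧
      ≡⟨ firstExponent e ⟩
    mulX (suc (toℕ k)) (above (suc l)) (e ∷ m) ∎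
    where
    firstExponent : ∀ e → ∑[ τ ∈ allVec (length m) n ] ⟦ all≥ l τ ∧ P τ ∧ ((0 ≡ᵇ e) ∧ (weight (k ∷ τ) == m)) ⟧
                       ≡ mulX (suc (toℕ k)) (above (suc l)) (e ∷ m)
    firstExponent zero    = trans (withRoot≡mulX m k l k≤l) (mulX-cong (toℕ k) (λ a → sym (above-suc l (zero ∷ a))) m)
    firstExponent (suc e) = trans (∑-zero (allVec (length m) n) (λ τ → cong ⟦_⟧ (∧-∧-false (all≥ l τ) (P τ))))
                               (sym (trans (mulX-cong (toℕ k) (λ a → above-suc l (suc e ∷ a)) m) (mulX-zero (toℕ k) m)))

next-≥ : ∀ strict j → j ≤ next strict j
next-≥ true  j = n≤1+n j
next-≥ false j = ≤-refl

coeffP-node : ∀ strict ts m →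
  coeffP strict (node ts) m ≡ ∑[ j ∈ upTo (length m) ] mulX j (shiftN (next strict j) (prodS (map (coeffP strict) ts))) m
coeffP-node strict ts m = begin
  coeffP strict (node ts) m
    ≡⟨ countB≡∑ _ (allVec L (suc n)) ⟩
  ∑[ σ ∈ allVec L (suc n) ] ⟦ orderOK strict (ltT (node ts)) σ ∧ weightOK σ ⟧
    ≡⟨ ∑-allVec-suc L n _ ⟩
  ∑[ τ ∈ allVec L n ] ∑[ k ∈ allFin L ] ⟦ orderOK strict (ltT (node ts)) (k ∷ τ) ∧ weightOK (k ∷ τ) ⟧
    ≡⟨ ∑-comm (allVec L n) (allFin L) _ ⟩
  ∑[ k ∈ allFin L ] ∑[ τ ∈ allVec L n ] ⟦ orderOK strict (ltT (node ts)) (k ∷ τ) ∧ weightOK (k ∷ τ) ⟧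
    ≡⟨ ∑-cong (allFin L) (λ k → ∑-cong (allVec L n) (λ τ → cong ⟦_⟧ (splitRoot k τ))) ⟩
  ∑[ k ∈ allFin L ] R.withRoot m k (next strict (toℕ k))
    ≡⟨ ∑-cong (allFin L) (λ k → trans (R.withRoot≡mulX m k _ (next-≥ strict (toℕ k)))
                                      (mulX-cong (toℕ k) (above≡shiftN-F (next strict (toℕ k))) m)) ⟩
  ∑[ k ∈ allFin L ] mulX (toℕ k) (shiftN (next strict (toℕ k)) F) m
    ≡⟨ ∑-allFin-toℕ L (λ j → mulX j (shiftN (next strict j) F) m) ⟩
  ∑[ j ∈ upTo L ] mulX j (shiftN (next strict j) F) m ∎
  where
  L = length m
  n = sizeF ts
  F = prodS (map (coeffP strict) ts)
  module R = LabelsAbove n (orderOK strict (ltF ts)) (orderOK-map-suc strict (ltF ts))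
  weightOK : ∀ {n} → Vec (Fin L) n → Bool
  weightOK σ = allL (λ k → occ k σ ≡ᵇ lookup m k) (allFin L)
  splitRoot : ∀ k τ → orderOK strict (ltT (node ts)) (k ∷ τ) ∧ weightOK (k ∷ τ)
                    ≡ all≥ (next strict (toℕ k)) τ ∧ orderOK strict (ltF ts) τ ∧ (weight (k ∷ τ) == m)
  splitRoot k τ = trans (cong₂ _∧_ (orderOK-node strict ts k τ) (all-≡ᵇ-lookup m (λ i → occ i (k ∷ τ))))
                        (∧-assoc (all≥ (next strict (toℕ k)) τ) _ _)
  above-zero : ∀ a → R.above 0 a ≡ F a
  above-zero a = trans (∑-cong (allVec (length a) n) term) (labellings-forest strict ts a)
    where
    term : ∀ τ → ⟦ all≥ 0 τ ∧ orderOK strict (ltF ts) τ ∧ (weight τ == a) ⟧ ≡ labelled strict (ltF ts) τ a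
    term τ = trans (cong (λ b → ⟦ b ∧ orderOK strict (ltF ts) τ ∧ (weight τ == a) ⟧) (all≥-zero τ))
                   (⟦∧⟧ (orderOK strict (ltF ts) τ) (weight τ == a))
  above≡shiftN-F : ∀ l a → R.above l a ≡ shiftN l F a
  above≡shiftN-F l a = trans (R.above≡shiftN l a) (shiftN-cong l above-zero a)

lemma7p3 : (ts : List Tree) (m : Mon) →
    (Kbar (node ts) m ≡ Λbar (prodS (map Kbar ts)) m) × (K (node ts) m ≡ Λ (prodS (map K ts)) m)
lemma7p3 ts m = coeffP-node true ts m , coeffP-node false ts m
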